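{- There is a satisfiable HyperLTL sentence that is not satisfied by any finite set of traces.
   Context: Fix a finite set $AP$ of atomic propositions. A trace over $AP$ is a map $t:\mathbb{N}\to 2^{AP}$. HyperLTL formulas are given by the grammar $\varphi ::= \exists \pi.\ \varphi \mid \forall \pi.\ \varphi \mid \psi$ and $\psi ::= a_\pi \mid \neg\psi \mid \psi\vee\psi \mid \mathbf{X}\psi \mid \psi\,\mathbf{U}\,\psi$, where $a\in AP$ and $\pi$ ranges over a countable set of trace variables. For a set $T$ of traces and a trace assignment $\Pi$ (a partial map from trace variables to traces), with $\Pi[j]$ denoting the assignment mapping each $\pi$ in the domain of $\Pi$ to the suffix $\Pi(\pi)(j)\Pi(\pi)(j+1)\cdots$: $(T,\Pi)\models a_\pi$ iff $a\in\Pi(\pi)(0)$; negation and disjunction are as usual; $(T,\Pi)\models\mathbf{X}\psi$ iff $(T,\Pi[1])\models\psi$; $(T,\Pi)\models\psi_1\mathbf{U}\psi_2$ iff there is $j\ge 0$ with $(T,\Pi[j])\models\psi_2$ and $(T,\Pi[j'])\models\psi_1$ for all $0\le j'<j$; $(T,\Pi)\models\exists\pi.\varphi$ iff there is $t\in T$ with $(T,\Pi[\pi\mapsto t])\models\varphi$; $(T,\Pi)\models\forall\pi.\varphi$ iff this holds for all $t\in T$. A sentence is a formula without free trace variables; $T$ satisfies (is a model of) a sentence $\varphi$ if $(T,\Pi_\emptyset)\models\varphi$ for the empty assignment $\Pi_\emptyset$. A sentence is satisfiable if it has a model. -}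

module Defs where

open import Data.Nat using (ℕ; zero; suc; _+_; _<_)
open import Data.Fin using (Fin; zero; suc)
open import Data.Bool using (Bool; true)
open import Data.Product using (Σ; _×_)
open import Data.Sum using (_⊎_)
open import Data.Empty using (⊥)
open import Relation.Binary.PropositionalEquality using (_≡_)
open import Relation.Nullary using (¬_)

-- Atomic propositions: AP = Fin k.  A letter of 2^AP is a characteristic
-- function AP → Bool.
Letter : ℕ → Set
Letter k = Fin k → Bool

Trace : ℕ → Set
Trace k = ℕ → Letter k

suffix : ∀ {k} → ℕ → Trace k → Trace k
suffix j t i = t (i + j)

-- Quantifier-free part ψ, with trace variables as de Bruijn indices Fin n.
data LTL (k n : ℕ) : Set where
  ap   : Fin k → Fin n → LTL k n
  ¬'_  : LTL k n → LTL k n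
  _∨'_ : LTL k n → LTL k n → LTL k n
  X    : LTL k n → LTL k n
  _U_  : LTL k n → LTL k n → LTL k n

data Hyper (k n : ℕ) : Set where
  ∃π   : Hyper k (suc n) → Hyper k n
  ∀π   : Hyper k (suc n) → Hyper k n
  body : LTL k n → Hyper k n

Sentence : ℕ → Set
Sentence k = Hyper k 0

Assignment : ℕ → ℕ → Set
Assignment k n = Fin n → Trace k

shiftA : ∀ {k n} → ℕ → Assignment k n → Assignment k n
shiftA j Π x = suffix j (Π x)

extend : ∀ {k n} → Trace k → Assignment k n → Assignment k (suc n)
extend t Π zero    = t
extend t Π (suc x) = Π x

-- (T,Π) ⊨ ψ  (does not depend on T)
_⊨L_ : ∀ {k n} → Assignment k n → LTL k n → Set
Π ⊨L ap a x    = Π x 0 a ≡ true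
Π ⊨L (¬' ψ)    = ¬ (Π ⊨L ψ)
Π ⊨L (ψ ∨' χ)  = (Π ⊨L ψ) ⊎ (Π ⊨L χ)
Π ⊨L X ψ       = shiftA 1 Π ⊨L ψ
Π ⊨L (ψ U χ)   = Σ ℕ λ j → (shiftA j Π ⊨L χ) × (∀ j' → j' < j → shiftA j' Π ⊨L ψ)

-- A set of traces T is represented as the image of a family  f : I → Trace k
-- (T = { f i | i : I }); quantification over t ∈ T is quantification over I.
record TraceSet (k : ℕ) : Set₁ where
  constructor traceSet
  field
    Index : Set
    elem  : Index → Trace k
open TraceSet public

sat : ∀ {k n} → TraceSet k → Assignment k n → Hyper k n → Set
sat T Π (∃π φ)   = Σ (Index T) λ i → sat T (extend (elem T i) Π) φ
sat T Π (∀π φ)   = ∀ (i : Index T) → sat T (extend (elem T i) Π) φ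
sat T Π (body ψ) = Π ⊨L ψ

emptyAssignment : ∀ {k} → Assignment k 0
emptyAssignment ()

_⊨_ : ∀ {k} → TraceSet k → Sentence k → Set
T ⊨ φ = sat T emptyAssignment φ

Satisfiable : ∀ {k} → Sentence k → Set₁
Satisfiable {k} φ = Σ (TraceSet k) λ T → T ⊨ φ

finiteSet : ∀ {k} (m : ℕ) → (Fin m → Trace k) → TraceSet k
finiteSet m f = traceSet (Fin m) f

-- The sentence  ∃π₀ ∀π₁ ∃π₂. a_π₀ ∧ ((¬a_π₁ ∧ ¬a_π₂) U (a_π₁ ∧ ¬a_π₂ ∧ X a_π₂))
-- says that some trace has its first a at position 0 and that for every trace
-- with its first a at position n there is one with its first a at n + 1.  Its
-- models therefore contain traces whose first a occurs at every position, so
-- infinitely many distinct traces; the traces carrying a exactly at one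
-- position n form such a model.
module Submission where

open import Defs
open import Data.Nat using (ℕ; _≥_)
open import Data.Fin using (Fin)
open import Data.Product using (Σ; _×_)
open import Relation.Nullary using (¬_)

open import Data.Bool using (true)
import Data.Bool as Bool
open import Data.Bool.Properties using (T-≡)
open import Data.Empty using (⊥-elim)
open import Data.Fin using (zero; suc; toℕ)
open import Data.Fin.Properties using (pigeonhole)
open import Data.Nat using (zero; suc; _<_; _≡ᵇ_)
open import Data.Nat.Properties
  using (<-cmp; <-irrefl; n<1+n; m<n⇒m<1+n; <⇒≢; m<1+n⇒m<n∨m≡n; ≡ᵇ⇒≡; ≡⇒≡ᵇ)
open import Data.Product using (_,_; proj₁; proj₂)
open import Data.Sum using (_⊎_; inj₁; inj₂; [_,_]′)
open import Function using (_∘_)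
open import Function.Bundles using (Equivalence)
open import Relation.Binary using (tri<; tri≈; tri>)
open import Relation.Binary.PropositionalEquality using (_≡_; refl; sym; subst)
open import Relation.Nullary.Decidable using (decidable-stable)
open import Relation.Nullary.Negation using (Stable; contradiction; ¬¬-map; negated-stable)

-- Conjunction is encoded through negation, so constructively only the double
-- negation of each conjunct is recovered; the facts extracted below are all
-- ¬¬-stable.
infixr 15 _∧'_

_∧'_ : ∀ {k n} → LTL k n → LTL k n → LTL k n
ψ ∧' χ = ¬' ((¬' ψ) ∨' (¬' χ))

∧-intro : ∀ {P Q : Set} → P → Q → ¬ (¬ P ⊎ ¬ Q)
∧-intro p q = [ contradiction p , contradiction q ]′

≡true-stable : ∀ {b} → Stable (b ≡ true)
≡true-stable = decidable-stable (_ Bool.≟ true)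

record FirstAt {k} (a : Fin k) (t : Trace k) (n : ℕ) : Set where
  constructor firstAt
  field
    present       : t n a ≡ true
    absent-before : ∀ j → j < n → ¬ t j a ≡ true

open FirstAt

module _ {k} {a : Fin k} {t : Trace k} where

  firstAt-unique : ∀ {n n'} → FirstAt a t n → FirstAt a t n' → n ≡ n'
  firstAt-unique {n} {n'} (firstAt at-n before-n) (firstAt at-n' before-n') with <-cmp n n'
  ... | tri< n<n' _ _ = ⊥-elim (before-n' n n<n' at-n)
  ... | tri≈ _ n≡n' _ = n≡n'
  ... | tri> _ _ n>n' = ⊥-elim (before-n n' n>n' at-n')

  firstAt-stable : ∀ {n} → Stable (FirstAt a t n)
  firstAt-stable ¬¬fa =
    firstAt (≡true-stable (¬¬-map present ¬¬fa))
            (λ j j<n → negated-stable (¬¬-map (λ fa → absent-before fa j j<n) ¬¬fa))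

firstFollows : ∀ {k n} → Fin k → Fin n → Fin n → LTL k n
firstFollows a x y =
  (¬' ap a x ∧' ¬' ap a y) U (ap a x ∧' (¬' ap a y ∧' X (ap a y)))

module _ {k n} {Π : Assignment k n} {a : Fin k} {x y : Fin n} where

  firstFollows-intro : ∀ {m} → FirstAt a (Π x) m → FirstAt a (Π y) (suc m) →
                       Π ⊨L firstFollows a x y
  firstFollows-intro {m} (firstAt ax before-x) (firstAt ay before-y) =
    m ,
    ∧-intro ax (∧-intro (before-y m (n<1+n m)) ay) ,
    λ j j<m → ∧-intro (before-x j j<m) (before-y j (m<n⇒m<1+n j<m))

  neither-elim : ∀ j → shiftA j Π ⊨L (¬' ap a x ∧' ¬' ap a y) →
                 (¬ Π x j a ≡ true) × (¬ Π y j a ≡ true)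
  neither-elim j p = (λ ax → p (inj₁ (contradiction ax))) ,
                     (λ ay → p (inj₂ (contradiction ay)))

  handover-elim : ∀ j → shiftA j Π ⊨L (ap a x ∧' (¬' ap a y ∧' X (ap a y))) →
                  (Π x j a ≡ true) × (¬ Π y j a ≡ true) × (Π y (suc j) a ≡ true)
  handover-elim j p = ≡true-stable (p ∘ inj₁) ,
                      (λ ay → rest (inj₁ (contradiction ay))) ,
                      ≡true-stable (rest ∘ inj₂)
    where
    rest : shiftA j Π ⊨L (¬' ap a y ∧' X (ap a y))
    rest q = p (inj₂ (contradiction q))

  firstFollows-elim : ∀ {m} → Π ⊨L firstFollows a x y →
                      FirstAt a (Π x) m → FirstAt a (Π y) (suc m)
  firstFollows-elim (j , now , earlier) fa-x with handover-elim j now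
  ... | ax , ¬ay , ay′ =
    subst (FirstAt a (Π y) ∘ suc) (firstAt-unique first-x fa-x) first-y
    where
    first-x : FirstAt a (Π x) j
    first-x = firstAt ax (λ j' j'<j → proj₁ (neither-elim j' (earlier j' j'<j)))

    first-y : FirstAt a (Π y) (suc j)
    first-y = firstAt ay′ before
      where
      before : ∀ j' → j' < suc j → ¬ Π y j' a ≡ true
      before j' j'<1+j with m<1+n⇒m<n∨m≡n j'<1+j
      ... | inj₁ j'<j = proj₂ (neither-elim j' (earlier j' j'<j))
      ... | inj₂ refl = ¬ay

-- De Bruijn indices count binders outwards, so the outermost trace is π₀ = 2.
π₀ π₁ π₂ : Fin 3
π₀ = suc (suc zero)
π₁ = suc zero
π₂ = zero

binding : ∀ {k} → Trace k → Trace k → Trace k → Assignment k 3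
binding t₀ t₁ t₂ = extend t₂ (extend t₁ (extend t₀ emptyAssignment))

staircase : ∀ {k} → Fin k → Sentence k
staircase a = ∃π (∀π (∃π (body (ap a π₀ ∧' firstFollows a π₁ π₂))))

staircase-unbounded : ∀ {k} {a : Fin k} (T : TraceSet k) → T ⊨ staircase a →
                      ∀ n → Σ (Index T) λ i → FirstAt a (elem T i) n
staircase-unbounded {k} {a} T (i₀ , next) = climb
  where
  climb : ∀ n → Σ (Index T) λ i → FirstAt a (elem T i) n
  climb zero = i₀ , firstAt (≡true-stable (proj₂ (next i₀) ∘ inj₁)) (λ _ ())
  climb (suc n) with climb n
  ... | i , first-i with next i
  ... | i′ , holds = i′ , firstAt-stable (¬¬-map step (holds ∘ inj₂))
    where
    Π : Assignment k 3
    Π = binding (elem T i₀) (elem T i) (elem T i′)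

    step : Π ⊨L firstFollows a π₁ π₂ → FirstAt a (elem T i′) (suc n)
    step ff = firstFollows-elim {Π = Π} {x = π₁} {y = π₂} ff first-i

spike : ∀ {k} → ℕ → Trace k
spike n i _ = i ≡ᵇ n

spike-firstAt : ∀ {k} (a : Fin k) n → FirstAt a (spike n) n
spike-firstAt a n =
  firstAt (Equivalence.to T-≡ (≡⇒≡ᵇ n n refl))
          (λ j j<n → <⇒≢ j<n ∘ ≡ᵇ⇒≡ j n ∘ Equivalence.from T-≡)

spikes : ∀ {k} → TraceSet k
spikes = traceSet ℕ spike

spikes⊨staircase : ∀ {k} (a : Fin k) → spikes ⊨ staircase a
spikes⊨staircase a = 0 , λ i → suc i ,
  ∧-intro (present (spike-firstAt a 0))
          (firstFollows-intro {Π = binding (spike 0) (spike i) (spike (suc i))} {x = π₁} {y = π₂}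
                              (spike-firstAt a i) (spike-firstAt a (suc i)))

finite-¬cover-ℕ : ∀ {m} (R : Fin m → ℕ → Set) →
                  (∀ {i n n'} → R i n → R i n' → n ≡ n') →
                  ¬ (∀ n → Σ (Fin m) λ i → R i n)
finite-¬cover-ℕ {m} R functional cover
  with p , q , p<q , same ← pigeonhole (n<1+n m) (proj₁ ∘ cover ∘ toℕ) =
  <-irrefl (functional (proj₂ (cover (toℕ p)))
                       (subst (λ i → R i (toℕ q)) (sym same) (proj₂ (cover (toℕ q)))))
           p<q

theorem1 : (k : ℕ) → k ≥ 1 →
    Σ (Sentence k) λ φ → Satisfiable φ ×
      ((m : ℕ) (f : Fin m → Trace k) → ¬ (finiteSet m f ⊨ φ))
theorem1 (suc k) _ =
  staircase a , (spikes , spikes⊨staircase a) ,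
  λ m f f⊨φ → finite-¬cover-ℕ (λ i → FirstAt a (f i)) firstAt-unique
                               (staircase-unbounded (finiteSet m f) f⊨φ)
  where
  a : Fin (suc k)
  a = zero
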